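{- Given a $k$-dominating set $D$ of a graph $G$, a pair $x,y\in D$ of vertices and any fixed node $c\in V$, define $f_c(z)= \frac{1}{2}\left( d(x,y) - d(x,z) - d(y,z)\right) + d(z,c) + 2k_z + k_{x} + k_{y}$ for any $z\in D$. Then, for each pair $u,v \in D$ and each quadruple $u',v',x',y'$ with respective associated dominators $u,v,x,y$, we have $2\tau(u',v',x',y') \leq f_c(u) + f_c(v)$.
   Context: $G=(V,E)$ is a finite, connected, unweighted, simple graph and $d(u,v)$ denotes the shortest-path distance in $G$. A $k$-dominating set is a set $D\subseteq V$ such that every vertex is at distance at most $k$ from some vertex of $D$; each $v\in V$ has an associated dominator $D(v)\in D$ with $d(v,D(v))\le k$, $D^{ -1}(u)=\{v: D(v)=u\}$, and $k_u=\max_{v\in D^{ -1}(u)} d(u,v)$. Here $\tau(u,v,x,y)=\frac12\big(d(u,v)+d(x,y)-\max\{d(x,u)+d(y,v), d(x,v)+d(y,u)\}\big)$. -}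

module Defs where

open import Data.Nat using (ℕ; zero; suc; _≤_; _⊔_)
open import Data.Fin using (Fin)
open import Data.Fin.Properties using (_≟_)
open import Data.Integer as ℤ using (ℤ; +_; _-_; _+_)
open import Data.List using (List; foldr; map; filter; allFin)
open import Data.Product using (Σ; _×_)
open import Relation.Binary.PropositionalEquality using (_≡_)
open import Relation.Nullary using (¬_)

record Graph (n : ℕ) : Set₁ where
  field
    Adj     : Fin n → Fin n → Set
    Adj-sym : ∀ {u v} → Adj u v → Adj v u
    Adj-irr : ∀ {u} → ¬ Adj u u
open Graph public

data Walk {n : ℕ} (G : Graph n) : Fin n → Fin n → ℕ → Set where
  here : ∀ {u} → Walk G u u 0
  step : ∀ {u w v ℓ} → Adj G u w → Walk G w v ℓ → Walk G u v (suc ℓ)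

Connected : ∀ {n} → Graph n → Set
Connected {n} G = ∀ (u v : Fin n) → Σ ℕ (λ ℓ → Walk G u v ℓ)

IsShortestPathDist : ∀ {n} → Graph n → (Fin n → Fin n → ℕ) → Set
IsShortestPathDist {n} G d =
  ∀ (u v : Fin n) → Walk G u v (d u v) × (∀ ℓ → Walk G u v ℓ → d u v ≤ ℓ)

-- k_u = max_{v ∈ D^{-1}(u)} d(u,v)   (0 if D^{-1}(u) is empty)
kOf : ∀ {n} → (Fin n → Fin n → ℕ) → (Fin n → Fin n) → Fin n → ℕ
kOf {n} d D u = foldr _⊔_ 0 (map (d u) (filter (λ v → D v ≟ u) (allFin n)))

twiceTau : ∀ {n} → (Fin n → Fin n → ℕ) → Fin n → Fin n → Fin n → Fin n → ℤ
twiceTau d u v x y =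
  + (d u v Data.Nat.+ d x y) - + ((d x u Data.Nat.+ d y v) ⊔ (d x v Data.Nat.+ d y u))

twiceF : ∀ {n} → (Fin n → Fin n → ℕ) → (Fin n → Fin n) → (x y c z : Fin n) → ℤ
twiceF d D x y c z =
  + d x y - + d x z - + d y z
  + (+ 2) ℤ.* (+ d z c) + (+ 4) ℤ.* (+ kOf d D z)
  + (+ 2) ℤ.* (+ kOf d D x) + (+ 2) ℤ.* (+ kOf d D y)

-- Every term of 2 f_c(u) + 2 f_c(v) - 4 τ(u',v',x',y') can be paid for by the
-- metric: the triangle inequality moves each of u',v',x',y' to its dominator at
-- the price of its radius k, d(u,v) ≤ d(u,c) + d(v,c) absorbs the terms in c,
-- and the sum of the two candidates for the maximum in τ is at most twice that
-- maximum.  The difference is thus an explicit nonnegative integer combination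
-- of the slacks of these inequalities.
module Submission where

open import Defs
open import Data.Nat using (ℕ; _≤_)
open import Data.Fin using (Fin)
open import Data.Fin.Subset using (Subset; _∈_)
open import Data.Integer as ℤ using (+_; _+_; _*_)
open import Relation.Binary.PropositionalEquality using (_≡_)

open import Data.Nat as ℕ using (suc; _⊔_)
import Data.Nat.Properties as ℕ
import Data.Integer.Properties as ℤ
open import Data.Integer.Solver using (module +-*-Solver)
open import Data.Fin.Properties using (_≟_)
open import Data.List.Relation.Unary.Any as Any using ()
open import Data.List.Properties using (foldr-preservesᵒ)
open import Data.List.Membership.Propositional.Properties using (∈-allFin; ∈-map⁺; ∈-filter⁺)
open import Data.Product using (proj₁; proj₂)
open import Data.Sum using (inj₂; [_,_])
open import Function using (_∘_)
open import Relation.Binary.PropositionalEquality using (refl; sym; subst)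

module _ {n : ℕ} {G : Graph n} where

  infixr 5 _++ʷ_

  _++ʷ_ : ∀ {a b c l m} → Walk G a b l → Walk G b c m → Walk G a c (l ℕ.+ m)
  here     ++ʷ q = q
  step e p ++ʷ q = step e (p ++ʷ q)

  snocʷ : ∀ {a b c l} → Walk G a b l → Adj G b c → Walk G a c (suc l)
  snocʷ here       e = step e here
  snocʷ (step f p) e = step f (snocʷ p e)

  reverseʷ : ∀ {a b l} → Walk G a b l → Walk G b a l
  reverseʷ here       = here
  reverseʷ (step e p) = snocʷ (reverseʷ p) (Adj-sym G e)

module ShortestPathDist {n : ℕ} {G : Graph n} {d : Fin n → Fin n → ℕ}
                        (isDist : IsShortestPathDist G d) where

  d-minimal : ∀ {a b l} → Walk G a b l → d a b ≤ l
  d-minimal {a} {b} = proj₂ (isDist a b) _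

  d-walk : ∀ a b → Walk G a b (d a b)
  d-walk a b = proj₁ (isDist a b)

  d-triangle : ∀ a b c → d a c ≤ d a b ℕ.+ d b c
  d-triangle a b c = d-minimal (d-walk a b ++ʷ d-walk b c)

  d-sym : ∀ a b → d a b ≡ d b a
  d-sym a b = ℕ.≤-antisym (d-minimal (reverseʷ (d-walk b a)))
                          (d-minimal (reverseʷ (d-walk a b)))

  d-≤-via : ∀ a c b → d a b ≤ d a c ℕ.+ d b c
  d-≤-via a c b = subst (λ e → d a b ≤ d a c ℕ.+ e) (d-sym c b) (d-triangle a c b)

  d-detour : ∀ a' a b b' → d a' b' ≤ d a' a ℕ.+ d a b ℕ.+ d b b'
  d-detour a' a b b' = begin
    d a' b'                      ≤⟨ d-triangle a' b b' ⟩
    d a' b ℕ.+ d b b'            ≤⟨ ℕ.+-monoˡ-≤ (d b b') (d-triangle a' a b) ⟩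
    d a' a ℕ.+ d a b ℕ.+ d b b'  ∎
    where open ℕ.≤-Reasoning

d-≤-kOf : ∀ {n} (d : Fin n → Fin n → ℕ) (D : Fin n → Fin n) {u w : Fin n}
        → D w ≡ u → d u w ≤ kOf d D u
d-≤-kOf d D {u} {w} Dw≡u =
  foldr-preservesᵒ (λ a b → [ ℕ.m≤n⇒m≤n⊔o b , ℕ.m≤n⇒m≤o⊔n a ]) 0 _
    (inj₂ (Any.map ℕ.≤-reflexive
      (∈-map⁺ (d u) (∈-filter⁺ (λ v → D v ≟ u) (∈-allFin w) Dw≡u))))

module Dominators {n : ℕ} {G : Graph n} {d : Fin n → Fin n → ℕ}
                  (isDist : IsShortestPathDist G d) (D : Fin n → Fin n) where

  open ShortestPathDist isDist

  k : Fin n → ℕ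
  k = kOf d D

  d-≤-k : ∀ {u w} → D w ≡ u → d w u ≤ k u
  d-≤-k {u} {w} Dw≡u = subst (_≤ k u) (d-sym u w) (d-≤-kOf d D Dw≡u)

  d-≤-dominator-d : ∀ {a b a' b'} → D a' ≡ a → D b' ≡ b
                  → d a' b' ≤ k a ℕ.+ d a b ℕ.+ k b
  d-≤-dominator-d {a} {b} {a'} {b'} Da' Db' =
    ℕ.≤-trans (d-detour a' a b b')
              (ℕ.+-mono-≤ (ℕ.+-monoˡ-≤ (d a b) (d-≤-k Da')) (d-≤-kOf d D Db'))

  dominator-d-≤ : ∀ {a b a' b'} → D a' ≡ a → D b' ≡ b
                → d a b ≤ k a ℕ.+ d a' b' ℕ.+ k b
  dominator-d-≤ {a} {b} {a'} {b'} Da' Db' =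
    ℕ.≤-trans (d-detour a a' b' b)
              (ℕ.+-mono-≤ (ℕ.+-monoˡ-≤ (d a' b') (d-≤-kOf d D Da')) (d-≤-k Db'))

gap : ℕ → ℕ → ℤ.ℤ
gap a b = + b ℤ.- + a

gap-nonneg : ∀ {a b} → a ≤ b → ℤ.0ℤ ℤ.≤ gap a b
gap-nonneg = ℤ.i≤j⇒0≤j-i ∘ ℤ.+≤+

module _ {n : ℕ} (d : Fin n → Fin n → ℕ) (D : Fin n → Fin n) (x y c u v u' v' x' y' : Fin n) where

  private
    k : Fin n → ℕ
    k = kOf d D
    m₁ m₂ : ℕ
    m₁ = d x' u' ℕ.+ d y' v'
    m₂ = d x' v' ℕ.+ d y' u'

  twiceF+twiceF-2twiceTau≡slacks :
    twiceF d D x y c u + twiceF d D x y c v ℤ.- + 2 * twiceTau d u' v' x' y'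
    ≡ + 2 * gap (d u' v') (k u ℕ.+ d u v ℕ.+ k v)
    + + 2 * gap (d u v) (d u c ℕ.+ d v c)
    + + 2 * gap (d x' y') (k x ℕ.+ d x y ℕ.+ k y)
    + gap (d x u) (k x ℕ.+ d x' u' ℕ.+ k u)
    + gap (d y v) (k y ℕ.+ d y' v' ℕ.+ k v)
    + gap (d x v) (k x ℕ.+ d x' v' ℕ.+ k v)
    + gap (d y u) (k y ℕ.+ d y' u' ℕ.+ k u)
    + gap (m₁ ℕ.+ m₂) (m₁ ⊔ m₂ ℕ.+ (m₁ ⊔ m₂))
  twiceF+twiceF-2twiceTau≡slacks = solve 19
    (λ ku kv kx ky duv dxy dxu dyv dxv dyu duc dvc duv' dxy' dxu' dyv' dxv' dyu' M →
      (dxy :- dxu :- dyu :+ con (+ 2) :* duc :+ con (+ 4) :* ku :+ con (+ 2) :* kx :+ con (+ 2) :* ky)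
      :+ (dxy :- dxv :- dyv :+ con (+ 2) :* dvc :+ con (+ 4) :* kv :+ con (+ 2) :* kx :+ con (+ 2) :* ky)
      :- con (+ 2) :* (duv' :+ dxy' :- M)
      := con (+ 2) :* (ku :+ duv :+ kv :- duv')
       :+ con (+ 2) :* (duc :+ dvc :- duv)
       :+ con (+ 2) :* (kx :+ dxy :+ ky :- dxy')
       :+ (kx :+ dxu' :+ ku :- dxu)
       :+ (ky :+ dyv' :+ kv :- dyv)
       :+ (kx :+ dxv' :+ kv :- dxv)
       :+ (ky :+ dyu' :+ ku :- dyu)
       :+ (M :+ M :- (dxu' :+ dyv' :+ (dxv' :+ dyu'))))
    refl
    (+ k u) (+ k v) (+ k x) (+ k y) (+ d u v) (+ d x y) (+ d x u) (+ d y v) (+ d x v) (+ d y u)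
    (+ d u c) (+ d v c) (+ d u' v') (+ d x' y') (+ d x' u') (+ d y' v') (+ d x' v') (+ d y' u')
    (+ (m₁ ⊔ m₂))
    where open +-*-Solver

lemma6 : ∀ {n : ℕ} (G : Graph n) → Connected G
       → (d : Fin n → Fin n → ℕ) → IsShortestPathDist G d
       → (k : ℕ) (Dset : Subset n) (D : Fin n → Fin n)
       → (∀ w → D w ∈ Dset) → (∀ w → d w (D w) ≤ k)
       → (x y : Fin n) → x ∈ Dset → y ∈ Dset → (c : Fin n)
       → (u v : Fin n) → u ∈ Dset → v ∈ Dset
       → (u' v' x' y' : Fin n)
       → D u' ≡ u → D v' ≡ v → D x' ≡ x → D y' ≡ y
       → (+ 2) * twiceTau d u' v' x' y' ℤ.≤ twiceF d D x y c u + twiceF d D x y c v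
lemma6 G _ d isDist _ _ D _ _ x y _ _ c u v _ _ u' v' x' y' Du' Dv' Dx' Dy' =
  ℤ.0≤i-j⇒j≤i (subst (ℤ.0ℤ ℤ.≤_) (sym (twiceF+twiceF-2twiceTau≡slacks d D x y c u v u' v' x' y'))
    (twice (gap-nonneg (d-≤-dominator-d Du' Dv'))
     ⊕ twice (gap-nonneg (d-≤-via u c v))
     ⊕ twice (gap-nonneg (d-≤-dominator-d Dx' Dy'))
     ⊕ gap-nonneg (dominator-d-≤ Dx' Du')
     ⊕ gap-nonneg (dominator-d-≤ Dy' Dv')
     ⊕ gap-nonneg (dominator-d-≤ Dx' Dv')
     ⊕ gap-nonneg (dominator-d-≤ Dy' Du')
     ⊕ gap-nonneg (ℕ.+-mono-≤ (ℕ.m≤m⊔n m₁ m₂) (ℕ.m≤n⊔m m₁ m₂))))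
  where
  open ShortestPathDist isDist
  open Dominators isDist D
  m₁ m₂ : ℕ
  m₁ = d x' u' ℕ.+ d y' v'
  m₂ = d x' v' ℕ.+ d y' u'
  infixl 6 _⊕_
  _⊕_ : ∀ {i j} → ℤ.0ℤ ℤ.≤ i → ℤ.0ℤ ℤ.≤ j → ℤ.0ℤ ℤ.≤ i + j
  _⊕_ = ℤ.+-mono-≤
  twice : ∀ {i} → ℤ.0ℤ ℤ.≤ i → ℤ.0ℤ ℤ.≤ + 2 * i
  twice = ℤ.*-monoˡ-≤-nonNeg (+ 2)
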